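{- For any types $A, B : \Box$ and any relation $R : A \to B \to \Box$, there is an equivalence of types \[\mathrm{isFun}(R) \simeq \mathrm{isUMap}(R).\]
   Context: The ambient setting is dependent type theory in the style of the Homotopy Type Theory book (dependent functions $\Pi$, dependent pairs $\Sigma$, the identity type $=$, function extensionality); $\Box$ denotes a universe. For $f,g : X \to Y$, pointwise equality is $f \doteqdot g := \Pi x : X.\, f\,x = g\,x$; $id$ is the identity function. $X \simeq Y$ is the usual (HoTT-book) type of equivalences between $X$ and $Y$. For a type $T$, $\mathrm{isContr}(T) := \Sigma t : T.\, \Pi t' : T.\, t = t'$. A relation $R : A \to B \to \Box$ is functional: $\mathrm{isFun}(R) := \Pi a : A.\, \mathrm{isContr}(\Sigma b : B.\, R\,a\,b)$. $R$ is a univalent map: $\mathrm{isUMap}(R)$ is the type of tuples consisting of a function $m : A \to B$, a function $g_1 : \Pi (a:A)(b:B).\, m\,a = b \to R\,a\,b$, a function $g_2 : \Pi (a:A)(b:B).\, R\,a\,b \to m\,a = b$, and a proof of $\Pi (a:A)(b:B).\,(g_1\,a\,b)\circ(g_2\,a\,b) \doteqdot id$ (i.e. $\Sigma m.\,\Sigma g_1.\,\Sigma g_2.\,\Pi a\,b.\,(g_1\,a\,b)\circ(g_2\,a\,b)\doteqdot id$). -}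

{-# OPTIONS --without-K #-}
module Defs where

open import Level using (Level; _⊔_)
open import Data.Product using (Σ; Σ-syntax; _,_; proj₁)
open import Relation.Binary.PropositionalEquality using (_≡_)
open import Function using (_∘_; id)

_≐_ : ∀ {a b} {X : Set a} {Y : X → Set b} → (f g : (x : X) → Y x) → Set (a ⊔ b)
f ≐ g = ∀ x → f x ≡ g x

-- function extensionality (an ambient axiom of the setting, taken as hypothesis)
FunExt : (a b : Level) → Set (Level.suc (a ⊔ b))
FunExt a b = {X : Set a} {Y : X → Set b} {f g : (x : X) → Y x} → f ≐ g → f ≡ g

isContr : ∀ {ℓ} → Set ℓ → Set ℓ
isContr T = Σ T λ t → (t' : T) → t ≡ t'

fib : ∀ {a b} {X : Set a} {Y : Set b} → (X → Y) → Y → Set (a ⊔ b)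
fib {X = X} f y = Σ X λ x → f x ≡ y

isEquiv : ∀ {a b} {X : Set a} {Y : Set b} → (X → Y) → Set (a ⊔ b)
isEquiv {Y = Y} f = (y : Y) → isContr (fib f y)

_≃_ : ∀ {a b} → Set a → Set b → Set (a ⊔ b)
X ≃ Y = Σ (X → Y) isEquiv

isFun : ∀ {ℓ} {A B : Set ℓ} → (A → B → Set ℓ) → Set ℓ
isFun {A = A} {B} R = (a : A) → isContr (Σ B λ b → R a b)

isUMap : ∀ {ℓ} {A B : Set ℓ} → (A → B → Set ℓ) → Set ℓ
isUMap {A = A} {B} R =
  Σ (A → B) λ m →
  Σ ((a : A) (b : B) → m a ≡ b → R a b) λ g₁ →
  Σ ((a : A) (b : B) → R a b → m a ≡ b) λ g₂ →
  (a : A) (b : B) → (g₁ a b ∘ g₂ a b) ≐ id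

{-# OPTIONS --safe --without-K #-}
-- Both sides are propositions: each is contractible as soon as it is inhabited, so it
-- suffices to map back and forth. A univalent map splits into one point-wise structure
-- per a : A, namely a point b₀ of B with maps b₀ ≡ b → R a b having sections. Given that
-- Σ B (R a) is contractible, the pairs (b₀ , g₁) form a contractible type (g₁ is determined
-- by g₁ b₀ refl), and at the centre g₁ b is transport of the centre of Σ B (R a), which is
-- an equivalence, so its sections form a contractible type; conversely such a structure contracts Σ B (R a) onto
-- (b₀ , g₁ b₀ refl).
module Submission where

open import Defs
open import Level using (Level; _⊔_)
open import Data.Product using (Σ; _,_; proj₁; proj₂)
open import Data.Product.Properties using (Σ-≡,≡↔≡; Σ-≡,≡→≡; Σ-≡,≡←≡)
open import Function using (_∘_; id)
open import Function.Bundles using (Inverse)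
open import Relation.Binary.PropositionalEquality using (_≡_; refl; sym; trans; cong; subst)
open import Relation.Binary.PropositionalEquality.Properties using (trans-symˡ)

private
  variable
    a b p : Level
    X Y : Set a

isContr-retract : (s : Y → X) (r : X → Y) → (r ∘ s) ≐ id → isContr X → isContr Y
isContr-retract s r rs (x₀ , c) = r x₀ , λ y → trans (cong r (c (s y))) (rs y)

≡-isContr : isContr X → (x y : X) → isContr (x ≡ y)
≡-isContr {X = X} (x₀ , c) x y = trans (sym (c x)) (c y) , contraction
  where
  contraction : {y : X} (q : x ≡ y) → trans (sym (c x)) (c y) ≡ q
  contraction refl = trans-symˡ (c x)

Σ-isContr : {Q : X → Set b} (cX : isContr X) → isContr (Q (proj₁ cX)) → isContr (Σ X Q)
Σ-isContr {X = X} {Q = Q} (x₀ , c) (q₀ , d) = (x₀ , q₀) , λ (x , q) → along (c x) q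
  where
  along : {x : X} (e : x₀ ≡ x) (q : Q x) → (x₀ , q₀) ≡ (x , q)
  along refl q = cong (x₀ ,_) (d q)

inhabited-isContr⇒isEquiv : (f : X → Y) → (Y → X)
  → (X → isContr X) → (Y → isContr Y) → isEquiv f
inhabited-isContr⇒isEquiv f g cX cY y = Σ-isContr (cX (g y)) (≡-isContr (cY y) _ y)

subst-from-refl : {B : Set b} {P : B → Set p} {b₀ : B} (g : (b : B) → b₀ ≡ b → P b)
  (b : B) (e : b₀ ≡ b) → subst P e (g b₀ refl) ≡ g b e
subst-from-refl g _ refl = refl

subst-isEquiv : {B : Set b} {P : B → Set p} (cΣ : isContr (Σ B P)) (b : B)
  → isEquiv (λ (e : proj₁ (proj₁ cΣ) ≡ b) → subst P e (proj₂ (proj₁ cΣ)))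
subst-isEquiv cΣ b r = isContr-retract Σ-≡,≡→≡ Σ-≡,≡←≡ (Inverse.strictlyInverseʳ Σ-≡,≡↔≡)
  (≡-isContr cΣ (proj₁ cΣ) (b , r))

hasSection : {X : Set a} {Y : Set b} → (X → Y) → Set (a ⊔ b)
hasSection {X = X} {Y = Y} f = Σ (Y → X) λ g → (f ∘ g) ≐ id

isUPoint : {B : Set b} → (B → Set p) → Set (b ⊔ p)
isUPoint {B = B} P = Σ B λ b₀ →
  Σ ((b : B) → b₀ ≡ b → P b) λ g₁ → Σ ((b : B) → P b → b₀ ≡ b) λ g₂ →
  (b : B) → (g₁ b ∘ g₂ b) ≐ id

isUMap→Π : {ℓ : Level} {A B : Set ℓ} {R : A → B → Set ℓ} → isUMap R → (a : A) → isUPoint (R a)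
isUMap→Π (m , g₁ , g₂ , η) a = m a , g₁ a , g₂ a , η a

Π→isUMap : {ℓ : Level} {A B : Set ℓ} {R : A → B → Set ℓ} → ((a : A) → isUPoint (R a)) → isUMap R
Π→isUMap u = (λ a → proj₁ (u a)) , (λ a → proj₁ (proj₂ (u a))) ,
             (λ a → proj₁ (proj₂ (proj₂ (u a)))) , (λ a → proj₂ (proj₂ (proj₂ (u a))))

isUPoint⇒isContr-Σ : {B : Set b} {P : B → Set p} → isUPoint P → isContr (Σ B P)
isUPoint⇒isContr-Σ (b₀ , g₁ , g₂ , η) = (b₀ , g₁ b₀ refl) ,
  λ (b , r) → trans (Σ-≡,≡→≡ (g₂ b r , subst-from-refl g₁ b (g₂ b r))) (cong (b ,_) (η b r))

module _ {ℓ : Level} (fe : FunExt ℓ ℓ) where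

  Π-isContr : {X : Set ℓ} {Q : X → Set ℓ} → ((x : X) → isContr (Q x)) → isContr ((x : X) → Q x)
  Π-isContr c = (λ x → proj₁ (c x)) , λ f → fe λ x → proj₂ (c x) (f x)

  isContr-isContr : {X : Set ℓ} → isContr X → isContr (isContr X)
  isContr-isContr c = Σ-isContr c (Π-isContr λ y → ≡-isContr c (proj₁ c) y)

  hasSection-isContr : {X Y : Set ℓ} {f : X → Y} → isEquiv f → isContr (hasSection f)
  hasSection-isContr e = isContr-retract
    (λ (g , η) y → g y , η y) (λ φ → proj₁ ∘ φ , proj₂ ∘ φ) (λ _ → refl) (Π-isContr e)

  based-maps-isContr : {B : Set ℓ} {P : B → Set ℓ} → isContr (Σ B P)
    → isContr (Σ B λ b₀ → (b : B) → b₀ ≡ b → P b)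
  based-maps-isContr {P = P} = isContr-retract
    (λ (b₀ , g) → b₀ , g b₀ refl) (λ (b₀ , r) → b₀ , λ b e → subst P e r)
    (λ (b₀ , g) → cong (b₀ ,_) (fe λ b → fe λ e → subst-from-refl g b e))

  isUPoint-isContr : {B : Set ℓ} {P : B → Set ℓ} → isContr (Σ B P) → isContr (isUPoint P)
  isUPoint-isContr {B = B} {P} cΣ = isContr-retract
    {X = Σ (Σ B λ b₀ → (b : B) → b₀ ≡ b → P b) λ (_ , g₁) → (b : B) → hasSection (g₁ b)}
    (λ (b₀ , g₁ , g₂ , η) → (b₀ , g₁) , λ b → g₂ b , η b)
    (λ ((b₀ , g₁) , s) → b₀ , g₁ , (λ b → proj₁ (s b)) , (λ b → proj₂ (s b)))
    (λ _ → refl)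
    (Σ-isContr (based-maps-isContr cΣ) (Π-isContr λ b → hasSection-isContr (subst-isEquiv cΣ b)))

  module _ {A B : Set ℓ} {R : A → B → Set ℓ} where

    isFun⇒isUMap : isFun R → isUMap R
    isFun⇒isUMap f = Π→isUMap λ a → proj₁ (isUPoint-isContr (f a))

    isUMap⇒isFun : isUMap R → isFun R
    isUMap⇒isFun u a = isUPoint⇒isContr-Σ (isUMap→Π u a)

    isFun-isContr : isFun R → isContr (isFun R)
    isFun-isContr f = Π-isContr λ a → isContr-isContr (f a)

    isUMap-isContr : isUMap R → isContr (isUMap R)
    isUMap-isContr u = isContr-retract isUMap→Π Π→isUMap (λ _ → refl)
      (Π-isContr λ a → isUPoint-isContr (isUMap⇒isFun u a))

lemma4 : {ℓ : Level} → FunExt ℓ ℓ → (A B : Set ℓ) (R : A → B → Set ℓ)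
    → isFun R ≃ isUMap R
lemma4 fe A B R = isFun⇒isUMap fe ,
  inhabited-isContr⇒isEquiv (isFun⇒isUMap fe) (isUMap⇒isFun fe) (isFun-isContr fe) (isUMap-isContr fe)
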